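{- Let $G$ be a graph, let $m\in\mathbb{N}$, and let $W\subseteq V(G)$ satisfy $|W|\ge m^2$. Call a vertex of $V(G)\setminus W$ exceptional (with respect to $W$ and $m$) if it has at most $m-1$ neighbors in $W$. Suppose that $e_G(X,Y)>0$ for all $X\subseteq V(G)\setminus W$ and all $Y\subseteq W$ with $|X|=|Y|=m$. Then there are at most $m-1$ exceptional vertices with respect to $W$ and $m$.
   Context: Graphs are finite, simple, undirected. For $X,Y\subseteq V(G)$, $e_G(X,Y)$ is the number of ordered pairs $(x,y)\in X\times Y$ with $\{x,y\}\in E(G)$. -}

module Defs where

open import Data.Nat using (ℕ; suc; _+_; _*_; _∸_; _≤_; _>_)
open import Data.Bool using (Bool; true; false; if_then_else_)
open import Data.Fin using (Fin)
open import Data.Fin.Subset using (Subset; _∈_; ∣_∣; _∩_; ∁)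
open import Data.Vec using (tabulate)
open import Data.List using (List; map; allFin)
open import Data.Nat.ListAction using (sum)
open import Data.Product using (_×_)
import Data.Vec
open import Relation.Binary.PropositionalEquality using (_≡_)
open import Relation.Nullary using (¬_)

record Graph (n : ℕ) : Set where
  field
    adj     : Fin n → Fin n → Bool
    sym     : ∀ u v → adj u v ≡ adj v u
    irrefl  : ∀ v → adj v v ≡ false

open Graph public

N : ∀ {n} → Graph n → Fin n → Subset n
N G v = tabulate (adj G v)

ind : Bool → ℕ
ind b = if b then 1 else 0

eG : ∀ {n} → Graph n → Subset n → Subset n → ℕ
eG {n} G X Y =
  sum (map (λ x → sum (map (λ y →
    ind (Data.Vec.lookup X x) * ind (Data.Vec.lookup Y y) * ind (adj G x y))
    (allFin n))) (allFin n))

Exceptional : ∀ {n} → Graph n → Subset n → ℕ → Fin n → Set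
Exceptional G W m v = (¬ (v ∈ W)) × (∣ N G v ∩ W ∣ ≤ m ∸ 1)

module Submission where

-- Suppose there were a set E of at least m exceptional
-- vertices and pick X ⊆ E with |X| = m.  Every x ∈ X has at most m - 1
-- neighbours in W, so the union U of the sets N(x) ∩ W over x ∈ X has at
-- most m(m - 1) elements.  Since |W| ≥ m² = m(m - 1) + m, at least m
-- vertices of W lie outside U; choose m of them as Y.  No edge joins X to Y,
-- so e_G(X,Y) = 0, contradicting the hypothesis for the m-sets X ⊆ V(G) ∖ W
-- and Y ⊆ W.

open import Defs
open import Data.Nat using (ℕ; zero; suc; _+_; _*_; _∸_; _≤_; _>_; z≤n; s≤s; _≤?_)
open import Data.Nat.Properties
  using (≤-refl; ≤-trans; ≤-reflexive; m≤n⇒m≤1+n; +-suc; +-mono-≤;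
         +-cancelˡ-≤; +-comm; *-suc; ≰⇒>; <-irrefl)
open import Data.Bool using (true; false)
open import Data.Fin using (Fin; zero; suc)
open import Data.Fin.Subset using (Subset; _∈_; _⊆_; ∣_∣; ∁; _∪_; _∩_; ⊥)
open import Data.Fin.Subset.Properties
  using (_∈?_; p⊆q⇒∣p∣≤∣q∣; x∈p∪q⁺; p⊆p∪q; q⊆p∪q; x∈p∩q⁺; x∈p∩q⁻;
         x∉p⇒x∈∁p; x∈∁p⇒x∉p; ∣⊥∣≡0; ⊥⊆; ⊆-trans)
open import Data.Vec using ([]; _∷_; lookup; here; there)
open import Data.Vec.Properties using (lookup⇒[]=; lookup∘tabulate)
open import Data.List using (List; map; allFin) renaming ([] to []ₗ; _∷_ to _∷ₗ_)
open import Data.Nat.ListAction using (sum)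
open import Data.Product using (∃-syntax; _×_; _,_)
open import Data.Sum using (inj₁; inj₂)
open import Data.Empty using (⊥-elim) renaming (⊥ to Empty)
open import Relation.Nullary using (yes; no; ¬_)
open import Relation.Binary.PropositionalEquality using (_≡_; refl; trans; cong) renaming (sym to ≡-sym)

∣p∪q∣≤∣p∣+∣q∣ : ∀ {n} (p q : Subset n) → ∣ p ∪ q ∣ ≤ ∣ p ∣ + ∣ q ∣
∣p∪q∣≤∣p∣+∣q∣ []          []          = z≤n
∣p∪q∣≤∣p∣+∣q∣ (true ∷ p)  (true ∷ q)  =
  s≤s (≤-trans (m≤n⇒m≤1+n (∣p∪q∣≤∣p∣+∣q∣ p q)) (≤-reflexive (≡-sym (+-suc _ _))))
∣p∪q∣≤∣p∣+∣q∣ (true ∷ p)  (false ∷ q) = s≤s (∣p∪q∣≤∣p∣+∣q∣ p q)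
∣p∪q∣≤∣p∣+∣q∣ (false ∷ p) (true ∷ q)  =
  ≤-trans (s≤s (∣p∪q∣≤∣p∣+∣q∣ p q)) (≤-reflexive (≡-sym (+-suc _ _)))
∣p∪q∣≤∣p∣+∣q∣ (false ∷ p) (false ∷ q) = ∣p∪q∣≤∣p∣+∣q∣ p q

∣p∣≤∣q∣+∣p∖q∣ : ∀ {n} (p q : Subset n) → ∣ p ∣ ≤ ∣ q ∣ + ∣ p ∩ ∁ q ∣
∣p∣≤∣q∣+∣p∖q∣ p q = ≤-trans (p⊆q⇒∣p∣≤∣q∣ p⊆q∪[p∖q]) (∣p∪q∣≤∣p∣+∣q∣ q (p ∩ ∁ q))
  where
  p⊆q∪[p∖q] : p ⊆ q ∪ (p ∩ ∁ q)
  p⊆q∪[p∖q] {x} x∈p with x ∈? q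
  ... | yes x∈q = x∈p∪q⁺ (inj₁ x∈q)
  ... | no  x∉q = x∈p∪q⁺ (inj₂ (x∈p∩q⁺ (x∈p , x∉p⇒x∈∁p x∉q)))

subset-of-size : ∀ {n} k (S : Subset n) → k ≤ ∣ S ∣ → ∃[ T ] (T ⊆ S × ∣ T ∣ ≡ k)
subset-of-size {n} zero S _ = ⊥ , ⊥⊆ , ∣⊥∣≡0 n
subset-of-size (suc k) (true ∷ S) (s≤s k≤∣S∣) with subset-of-size k S k≤∣S∣
... | T , T⊆S , ∣T∣≡k = true ∷ T , extend , cong suc ∣T∣≡k
  where
  extend : true ∷ T ⊆ true ∷ S
  extend here      = here
  extend (there x) = there (T⊆S x)
subset-of-size (suc k) (false ∷ S) k<∣S∣ with subset-of-size (suc k) S k<∣S∣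
... | T , T⊆S , ∣T∣≡k = false ∷ T , extend , ∣T∣≡k
  where
  extend : false ∷ T ⊆ false ∷ S
  extend (there x) = there (T⊆S x)

⋃[_]_ : ∀ {k n} → Subset k → (Fin k → Subset n) → Subset n
⋃[ []        ] f = ⊥
⋃[ true ∷ I  ] f = f zero ∪ ⋃[ I ] (λ i → f (suc i))
⋃[ false ∷ I ] f = ⋃[ I ] (λ i → f (suc i))

⊆-⋃ : ∀ {k n} (I : Subset k) (f : Fin k → Subset n) {i} → i ∈ I → f i ⊆ ⋃[ I ] f
⊆-⋃ (true ∷ I)  f here      = p⊆p∪q _
⊆-⋃ (true ∷ I)  f (there i) = ⊆-trans (⊆-⋃ I (λ j → f (suc j)) i) (q⊆p∪q (f zero) _)
⊆-⋃ (false ∷ I) f (there i) = ⊆-⋃ I (λ j → f (suc j)) i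

∣⋃∣≤ : ∀ {k n} (I : Subset k) (f : Fin k → Subset n) c →
  (∀ i → i ∈ I → ∣ f i ∣ ≤ c) → ∣ ⋃[ I ] f ∣ ≤ ∣ I ∣ * c
∣⋃∣≤ {n = n} []  f c _ = ≤-reflexive (∣⊥∣≡0 n)
∣⋃∣≤ (true ∷ I)  f c small = ≤-trans (∣p∪q∣≤∣p∣+∣q∣ (f zero) _)
  (+-mono-≤ (small zero here) (∣⋃∣≤ I (λ i → f (suc i)) c (λ i i∈I → small (suc i) (there i∈I))))
∣⋃∣≤ (false ∷ I) f c small = ∣⋃∣≤ I (λ i → f (suc i)) c (λ i i∈I → small (suc i) (there i∈I))

sum-map-zero : ∀ {A : Set} (f : A → ℕ) (xs : List A) → (∀ x → f x ≡ 0) → sum (map f xs) ≡ 0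
sum-map-zero f []ₗ        _    = refl
sum-map-zero f (x ∷ₗ xs) f≡0 rewrite f≡0 x = sum-map-zero f xs f≡0

eG-no-edges : ∀ {n} (G : Graph n) (X Y : Subset n) →
  (∀ x y → x ∈ X → y ∈ Y → adj G x y ≡ false) → eG G X Y ≡ 0
eG-no-edges {n} G X Y no-edge =
  sum-map-zero _ (allFin n) λ x → sum-map-zero _ (allFin n) λ y → term x y
  where
  term : ∀ x y → ind (lookup X x) * ind (lookup Y y) * ind (adj G x y) ≡ 0
  term x y with lookup X x in x∈X | lookup Y y in y∈Y | adj G x y in xy
  ... | false | _     | _     = refl
  ... | true  | false | _     = refl
  ... | true  | true  | false = refl
  ... | true  | true  | true
    with () ← trans (≡-sym xy) (no-edge x y (lookup⇒[]= x X x∈X) (lookup⇒[]= y Y y∈Y))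

-- Key step: if every vertex of X has at most d neighbours in W and
-- |X| · d + k ≤ |W|, then some k-subset Y of W receives no edge from X;
-- take Y inside W minus the union of the sets N(x) ∩ W.
avoid-neighbourhoods : ∀ {n} (G : Graph n) (W X : Subset n) (d k : ℕ) →
  (∀ x → x ∈ X → ∣ N G x ∩ W ∣ ≤ d) → ∣ X ∣ * d + k ≤ ∣ W ∣ →
  ∃[ Y ] (Y ⊆ W × ∣ Y ∣ ≡ k × (∀ x y → x ∈ X → y ∈ Y → adj G x y ≡ false))
avoid-neighbourhoods G W X d k few room with subset-of-size k (W ∩ ∁ U) k≤∣W∖U∣
  where
  U = ⋃[ X ] (λ x → N G x ∩ W)
  k≤∣W∖U∣ : k ≤ ∣ W ∩ ∁ U ∣
  k≤∣W∖U∣ = +-cancelˡ-≤ (∣ X ∣ * d) _ _ (≤-trans room (≤-trans (∣p∣≤∣q∣+∣p∖q∣ W U)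
              (+-mono-≤ (∣⋃∣≤ X (λ x → N G x ∩ W) d few) ≤-refl)))
... | Y , Y⊆W∖U , ∣Y∣≡k = Y , Y⊆W , ∣Y∣≡k , no-edge
  where
  Y⊆W : Y ⊆ W
  Y⊆W y∈Y with x∈p∩q⁻ W _ (Y⊆W∖U y∈Y)
  ... | y∈W , _ = y∈W
  no-edge : ∀ x y → x ∈ X → y ∈ Y → adj G x y ≡ false
  no-edge x y x∈X y∈Y with adj G x y in xy | x∈p∩q⁻ W _ (Y⊆W∖U y∈Y)
  ... | false | _         = refl
  ... | true  | y∈W , y∉U = ⊥-elim (x∈∁p⇒x∉p y∉U
        (⊆-⋃ X (λ v → N G v ∩ W) x∈X (x∈p∩q⁺ (y∈N[x] , y∈W))))
    where
    y∈N[x] : y ∈ N G x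
    y∈N[x] = lookup⇒[]= y (N G x) (trans (lookup∘tabulate (adj G x) y) xy)

-- m² = m(m - 1) + m; this holds for m = 0 too, with truncated subtraction.
m*m≡m*[m∸1]+m : ∀ m → m * m ≡ m * (m ∸ 1) + m
m*m≡m*[m∸1]+m zero    = refl
m*m≡m*[m∸1]+m (suc k) = trans (*-suc (suc k) k) (+-comm (suc k) (suc k * k))

≰-pred⇒≥ : ∀ {e} m → ¬ (e ≤ m ∸ 1) → m ≤ e
≰-pred⇒≥ zero    _   = z≤n
≰-pred⇒≥ (suc k) e≰k = ≰⇒> e≰k

-- Under the density hypothesis no m vertices can all be exceptional: the
-- m-subset Y of W avoiding their neighbourhoods would give e_G(X,Y) = 0.
no-m-exceptional-vertices : ∀ {n} (G : Graph n) (m : ℕ) (W : Subset n) →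
    m * m ≤ ∣ W ∣ →
    (∀ (X Y : Subset n) → X ⊆ ∁ W → Y ⊆ W → ∣ X ∣ ≡ m → ∣ Y ∣ ≡ m → eG G X Y > 0) →
    ∀ (X : Subset n) → (∀ v → v ∈ X → Exceptional G W m v) → ∣ X ∣ ≡ m → Empty
no-m-exceptional-vertices G m W ∣W∣≥m² dense X exceptional ∣X∣≡m =
  edgeless-pair (avoid-neighbourhoods G W X (m ∸ 1) m few-neighbours room)
  where
  X⊆∁W : X ⊆ ∁ W
  X⊆∁W x∈X with exceptional _ x∈X
  ... | x∉W , _ = x∉p⇒x∈∁p x∉W
  few-neighbours : ∀ x → x ∈ X → ∣ N G x ∩ W ∣ ≤ m ∸ 1
  few-neighbours x x∈X with exceptional x x∈X
  ... | _ , few = few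
  room : ∣ X ∣ * (m ∸ 1) + m ≤ ∣ W ∣
  room rewrite ∣X∣≡m = ≤-trans (≤-reflexive (≡-sym (m*m≡m*[m∸1]+m m))) ∣W∣≥m²
  edgeless-pair : ∃[ Y ] (Y ⊆ W × ∣ Y ∣ ≡ m × (∀ x y → x ∈ X → y ∈ Y → adj G x y ≡ false)) →
                  Empty
  edgeless-pair (Y , Y⊆W , ∣Y∣≡m , no-edge) =
    <-irrefl (≡-sym (eG-no-edges G X Y no-edge)) (dense X Y X⊆∁W Y⊆W ∣X∣≡m ∣Y∣≡m)

lemma3p3 : ∀ {n} (G : Graph n) (m : ℕ) (W : Subset n) →
    m * m ≤ ∣ W ∣ →
    (∀ (X Y : Subset n) → X ⊆ ∁ W → Y ⊆ W → ∣ X ∣ ≡ m → ∣ Y ∣ ≡ m → eG G X Y > 0) →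
    ∀ (E : Subset n) → (∀ v → v ∈ E → Exceptional G W m v) → ∣ E ∣ ≤ m ∸ 1
lemma3p3 G m W ∣W∣≥m² dense E exceptional with ∣ E ∣ ≤? m ∸ 1
... | yes ∣E∣≤m-1 = ∣E∣≤m-1
... | no  ∣E∣≰m-1 with X , X⊆E , ∣X∣≡m ← subset-of-size m E (≰-pred⇒≥ m ∣E∣≰m-1)
  = ⊥-elim (no-m-exceptional-vertices G m W ∣W∣≥m² dense X
              (λ v v∈X → exceptional v (X⊆E v∈X)) ∣X∣≡m)
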